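{- The system $\mathsf{DG}+\Pi^0_1\text{ - }\mathsf{TRANS}$ is inconsistent, where $\Pi^0_1\text{ - }\mathsf{TRANS}$ is the statement $(\forall^{\mathrm{st}}f^{1})\big[(\forall^{\mathrm{st}}n^0)(f(n)=0)\rightarrow(\forall n^0)(f(n)=0)\big]$.
   Context: Finite types: $0$ is a type and if $\rho,\sigma$ are types so is $\rho\to\sigma$; type $1=0\to0$, $2=1\to0$. $\mathsf{E\text{ - }HA}^{\omega}$ is Heyting arithmetic in all finite types (intuitionistic logic, Gödel's $T$ constants) with extensionality. Equality $=_0$ is primitive; for $\tau=\tau_1\to\dots\to\tau_k\to0$, $x=_\tau y$ abbreviates $(\forall z_1\dots z_k)(xz_1\dots z_k=_0yz_1\dots z_k)$, and $\le_\tau$ likewise. Extensionality $(\mathsf E_{\rho\to\tau})$: $(\forall\varphi)(\forall x,y)(x=_\rho y\to\varphi(x)=_\tau\varphi(y))$, for all types. Strong majorizability (Howard–Bezem): $x\le^*_0 y$ iff $x\le_0 y$; $x\le^*_{\rho\to\sigma}y$ iff for all $u,v$ with $u\le^*_\rho v$: $xu\le^*_\sigma yv$ and $yu\le^*_\sigma yv$. Monotone: $x\le^*x$; $\tilde\forall,\tilde\exists$ range over monotone objects. The language of $\mathsf{DG}$ adds predicates $\mathrm{st}^\sigma$ ("is standard"); $\forall^{\mathrm{st}},\exists^{\mathrm{st}}$ are the relativised quantifiers, $\tilde\forall^{\mathrm{st}},\tilde\exists^{\mathrm{st}}$ combine both restrictions. Internal = not containing $\mathrm{st}$. $\mathsf{DG}$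 is $\mathsf{E\text{ - }HA}^\omega$ in the extended language plus: (a) $x=_\sigma y\to(\mathrm{st}(x)\to\mathrm{st}(y))$; (b) $\mathrm{st}(y)\to(x\le^*_\sigma y\to\mathrm{st}(x))$; (c) $\mathrm{st}(t)$ for closed terms $t$; (d) $\mathrm{st}(z)\to(\mathrm{st}(x)\to\mathrm{st}(zx))$; external induction $\Phi(0)\wedge(\forall^{\mathrm{st}}n)(\Phi(n)\to\Phi(n+1))\to(\forall^{\mathrm{st}}n)\Phi(n)$ for any $\Phi$; and for arbitrary $\Phi,\Psi$ and internal $\phi,\psi$: $\mathsf{mAC}^\omega$: $(\tilde\forall^{\mathrm{st}}x)(\tilde\exists^{\mathrm{st}}y)\Phi(x,y)\to(\tilde\exists^{\mathrm{st}}f)(\tilde\forall^{\mathrm{st}}x)(\exists y\le^*f(x))\Phi(x,y)$; $\mathsf R^\omega$: $(\forall x)(\exists^{\mathrm{st}}y)\Phi(x,y)\to(\tilde\exists^{\mathrm{st}}z)(\forall x)(\exists y\le^*z)\Phi(x,y)$; $\mathsf I^\omega$: $(\tilde\forall^{\mathrm{st}}z)(\exists x)(\forall y\le^*z)\phi(x,y)\to(\exists x)(\forall^{\mathrm{st}}y)\phi(x,y)$; $\mathsf{IP}^\omega_{\tilde\forall^{\mathrm{st}}}$: $[(\tilde\forall^{\mathrm{st}}x)\phi(x)\to(\tilde\exists^{\mathrm{st}}y)\Psi(y)]\to(\tilde\exists^{\mathrm{st}}z)[(\tilde\forall^{\mathrm{st}}x)\phi(x)\to(\tilde\exists y\le^*z)\Psi(y)]$;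 $\mathsf M^\omega$: $[(\tilde\forall^{\mathrm{st}}x)\phi(x)\to\psi]\to(\tilde\exists^{\mathrm{st}}y)[(\forall x\le^*y)\phi(x)\to\psi]$; $\mathsf{MAJ}^\omega$: $(\forall^{\mathrm{st}}x)(\exists^{\mathrm{st}}y)(x\le^*y)$. -}

module Defs where

-- Deep embedding of the formal system DG (van den Berg–Briseid–Safarik style
-- nonstandard Heyting arithmetic in all finite types) and of derivability.

open import Data.List using (List; []; _∷_; map)
open import Data.List.Membership.Propositional using (_∈_)
open import Data.Sum using (_⊎_)

infixr 7 _⇒_
data Ty : Set where
  ι   : Ty
  _⇒_ : Ty → Ty → Ty

Ctx : Set
Ctx = List Ty

data _∋_ : Ctx → Ty → Set where
  here  : ∀ {Γ σ} → (σ ∷ Γ) ∋ σ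
  there : ∀ {Γ σ τ} → Γ ∋ σ → (τ ∷ Γ) ∋ σ

infixl 9 _·_
data Tm (Γ : Ctx) : Ty → Set where
  var  : ∀ {σ} → Γ ∋ σ → Tm Γ σ
  zero : Tm Γ ι
  succ : Tm Γ (ι ⇒ ι)
  K    : ∀ ρ σ → Tm Γ (ρ ⇒ σ ⇒ ρ)
  S    : ∀ ρ σ τ → Tm Γ ((ρ ⇒ σ ⇒ τ) ⇒ (ρ ⇒ σ) ⇒ ρ ⇒ τ)
  R    : ∀ ρ → Tm Γ (ρ ⇒ (ρ ⇒ ι ⇒ ρ) ⇒ ι ⇒ ρ)
  _·_  : ∀ {σ τ} → Tm Γ (σ ⇒ τ) → Tm Γ σ → Tm Γ τ

infix  6 _≐_
infixr 5 _∧'_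
infixr 4 _∨'_
infixr 3 _⇒'_
data Fm (Γ : Ctx) : Set where
  _≐_  : Tm Γ ι → Tm Γ ι → Fm Γ
  st   : ∀ σ → Tm Γ σ → Fm Γ
  ⊥'   : Fm Γ
  _∧'_ : Fm Γ → Fm Γ → Fm Γ
  _∨'_ : Fm Γ → Fm Γ → Fm Γ
  _⇒'_ : Fm Γ → Fm Γ → Fm Γ
  ∀'   : ∀ σ → Fm (σ ∷ Γ) → Fm Γ
  ∃'   : ∀ σ → Fm (σ ∷ Γ) → Fm Γ

data Internal : ∀ {Γ} → Fm Γ → Set where
  i≐ : ∀ {Γ} {s t : Tm Γ ι} → Internal (s ≐ t)
  i⊥ : ∀ {Γ} → Internal {Γ} ⊥'
  i∧ : ∀ {Γ} {φ ψ : Fm Γ} → Internal φ → Internal ψ → Internal (φ ∧' ψ)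
  i∨ : ∀ {Γ} {φ ψ : Fm Γ} → Internal φ → Internal ψ → Internal (φ ∨' ψ)
  i⇒ : ∀ {Γ} {φ ψ : Fm Γ} → Internal φ → Internal ψ → Internal (φ ⇒' ψ)
  i∀ : ∀ {Γ σ} {φ : Fm (σ ∷ Γ)} → Internal φ → Internal (∀' σ φ)
  i∃ : ∀ {Γ σ} {φ : Fm (σ ∷ Γ)} → Internal φ → Internal (∃' σ φ)

Ren : Ctx → Ctx → Set
Ren Γ Δ = ∀ {σ} → Γ ∋ σ → Δ ∋ σ

liftR : ∀ {Γ Δ τ} → Ren Γ Δ → Ren (τ ∷ Γ) (τ ∷ Δ)
liftR r here      = here
liftR r (there x) = there (r x)

renT : ∀ {Γ Δ σ} → Ren Γ Δ → Tm Γ σ → Tm Δ σ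
renT r (var x)   = var (r x)
renT r zero      = zero
renT r succ      = succ
renT r (K ρ σ)   = K ρ σ
renT r (S ρ σ τ) = S ρ σ τ
renT r (R ρ)     = R ρ
renT r (s · t)   = renT r s · renT r t

renF : ∀ {Γ Δ} → Ren Γ Δ → Fm Γ → Fm Δ
renF r (s ≐ t)  = renT r s ≐ renT r t
renF r (st σ t) = st σ (renT r t)
renF r ⊥'       = ⊥'
renF r (φ ∧' ψ) = renF r φ ∧' renF r ψ
renF r (φ ∨' ψ) = renF r φ ∨' renF r ψ
renF r (φ ⇒' ψ) = renF r φ ⇒' renF r ψ
renF r (∀' σ φ) = ∀' σ (renF (liftR r) φ)
renF r (∃' σ φ) = ∃' σ (renF (liftR r) φ)

wkT : ∀ {Γ σ τ} → Tm Γ σ → Tm (τ ∷ Γ) σ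
wkT = renT there

wkF : ∀ {Γ τ} → Fm Γ → Fm (τ ∷ Γ)
wkF = renF there

wk₂ : ∀ {Γ σ τ ρ} → Fm (τ ∷ σ ∷ Γ) → Fm (τ ∷ σ ∷ ρ ∷ Γ)
wk₂ = renF (liftR (liftR there))

wk₁ : ∀ {Γ σ ρ} → Fm (σ ∷ Γ) → Fm (σ ∷ ρ ∷ Γ)
wk₁ = renF (liftR there)

Sub : Ctx → Ctx → Set
Sub Γ Δ = ∀ {σ} → Γ ∋ σ → Tm Δ σ

liftS : ∀ {Γ Δ τ} → Sub Γ Δ → Sub (τ ∷ Γ) (τ ∷ Δ)
liftS s here      = var here
liftS s (there x) = wkT (s x)

subT : ∀ {Γ Δ σ} → Sub Γ Δ → Tm Γ σ → Tm Δ σ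
subT s (var x)   = s x
subT s zero      = zero
subT s succ      = succ
subT s (K ρ σ)   = K ρ σ
subT s (S ρ σ τ) = S ρ σ τ
subT s (R ρ)     = R ρ
subT s (t · u)   = subT s t · subT s u

subF : ∀ {Γ Δ} → Sub Γ Δ → Fm Γ → Fm Δ
subF s (t ≐ u)  = subT s t ≐ subT s u
subF s (st σ t) = st σ (subT s t)
subF s ⊥'       = ⊥'
subF s (φ ∧' ψ) = subF s φ ∧' subF s ψ
subF s (φ ∨' ψ) = subF s φ ∨' subF s ψ
subF s (φ ⇒' ψ) = subF s φ ⇒' subF s ψ
subF s (∀' σ φ) = ∀' σ (subF (liftS s) φ)
subF s (∃' σ φ) = ∃' σ (subF (liftS s) φ)

single : ∀ {Γ σ} → Tm Γ σ → Sub (σ ∷ Γ) Γ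
single t here      = t
single t (there x) = var x

_[_] : ∀ {Γ σ} → Fm (σ ∷ Γ) → Tm Γ σ → Fm Γ
φ [ t ] = subF (single t) φ

stepSub : ∀ {Γ} → Sub (ι ∷ Γ) (ι ∷ Γ)
stepSub here      = succ · var here
stepSub (there x) = var (there x)

_[suc] : ∀ {Γ} → Fm (ι ∷ Γ) → Fm (ι ∷ Γ)
φ [suc] = subF stepSub φ

closed : ∀ {Γ σ} → Tm [] σ → Tm Γ σ
closed = renT (λ ())

v0 : ∀ {Γ σ} → Tm (σ ∷ Γ) σ
v0 = var here

v1 : ∀ {Γ σ τ} → Tm (τ ∷ σ ∷ Γ) σ
v1 = var (there here)

eqT : ∀ {Γ} σ → Tm Γ σ → Tm Γ σ → Fm Γ
eqT ι       s t = s ≐ t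
eqT (ρ ⇒ τ) s t = ∀' ρ (eqT τ (wkT s · v0) (wkT t · v0))

-- addition as a term of T: add x y = R x (λ a b. S a) y
add : ∀ {Γ} → Tm Γ ι → Tm Γ ι → Tm Γ ι
add x y = R ι · x · (S ι ι (ι ⇒ ι) · (K (ι ⇒ ι ⇒ ι) ι · K ι ι) · succ) · y

leq0 : ∀ {Γ} → Tm Γ ι → Tm Γ ι → Fm Γ
leq0 x y = ∃' ι (add (wkT x) v0 ≐ wkT y)

-- strong majorizability  x ≤*_σ y  (Howard–Bezem)
maj : ∀ {Γ} σ → Tm Γ σ → Tm Γ σ → Fm Γ
maj ι       x y = leq0 x y
maj (ρ ⇒ τ) x y =
  ∀' ρ (∀' ρ (maj ρ v1 v0 ⇒'
     (maj τ (wkT (wkT x) · v1) (wkT (wkT y) · v0)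
      ∧' maj τ (wkT (wkT y) · v1) (wkT (wkT y) · v0))))

mono : ∀ {Γ} σ → Tm Γ σ → Fm Γ
mono σ x = maj σ x x

∀st ∃st ∀~ ∃~ ∀~st ∃~st : ∀ {Γ} σ → Fm (σ ∷ Γ) → Fm Γ
∀st  σ φ = ∀' σ (st σ v0 ⇒' φ)
∃st  σ φ = ∃' σ (st σ v0 ∧' φ)
∀~   σ φ = ∀' σ (mono σ v0 ⇒' φ)
∃~   σ φ = ∃' σ (mono σ v0 ∧' φ)
∀~st σ φ = ∀' σ ((st σ v0 ∧' mono σ v0) ⇒' φ)
∃~st σ φ = ∃' σ ((st σ v0 ∧' mono σ v0) ∧' φ)

∀≤ ∃≤ ∃~≤ : ∀ {Γ} σ → Tm Γ σ → Fm (σ ∷ Γ) → Fm Γ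
∀≤  σ b φ = ∀' σ (maj σ v0 (wkT b) ⇒' φ)
∃≤  σ b φ = ∃' σ (maj σ v0 (wkT b) ∧' φ)
∃~≤ σ b φ = ∃' σ ((mono σ v0 ∧' maj σ v0 (wkT b)) ∧' φ)

Theory : Set₁
Theory = (Γ : Ctx) → Fm Γ → Set

_⊕_ : Theory → Theory → Theory
(T ⊕ U) Γ φ = T Γ φ ⊎ U Γ φ

data Pf (T : Theory) : (Γ : Ctx) → List (Fm Γ) → Fm Γ → Set where
  hyp  : ∀ {Γ Δ φ} → φ ∈ Δ → Pf T Γ Δ φ
  ax   : ∀ {Γ Δ φ} → T Γ φ → Pf T Γ Δ φ
  ⊥E   : ∀ {Γ Δ φ} → Pf T Γ Δ ⊥' → Pf T Γ Δ φ
  ∧I   : ∀ {Γ Δ φ ψ} → Pf T Γ Δ φ → Pf T Γ Δ ψ → Pf T Γ Δ (φ ∧' ψ)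
  ∧E₁  : ∀ {Γ Δ φ ψ} → Pf T Γ Δ (φ ∧' ψ) → Pf T Γ Δ φ
  ∧E₂  : ∀ {Γ Δ φ ψ} → Pf T Γ Δ (φ ∧' ψ) → Pf T Γ Δ ψ
  ∨I₁  : ∀ {Γ Δ φ ψ} → Pf T Γ Δ φ → Pf T Γ Δ (φ ∨' ψ)
  ∨I₂  : ∀ {Γ Δ φ ψ} → Pf T Γ Δ ψ → Pf T Γ Δ (φ ∨' ψ)
  ∨E   : ∀ {Γ Δ φ ψ χ} → Pf T Γ Δ (φ ∨' ψ) → Pf T Γ (φ ∷ Δ) χ
         → Pf T Γ (ψ ∷ Δ) χ → Pf T Γ Δ χ
  ⇒I   : ∀ {Γ Δ φ ψ} → Pf T Γ (φ ∷ Δ) ψ → Pf T Γ Δ (φ ⇒' ψ)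
  ⇒E   : ∀ {Γ Δ φ ψ} → Pf T Γ Δ (φ ⇒' ψ) → Pf T Γ Δ φ → Pf T Γ Δ ψ
  ∀I   : ∀ {Γ Δ σ φ} → Pf T (σ ∷ Γ) (map wkF Δ) φ → Pf T Γ Δ (∀' σ φ)
  ∀E   : ∀ {Γ Δ σ φ} → Pf T Γ Δ (∀' σ φ) → (t : Tm Γ σ) → Pf T Γ Δ (φ [ t ])
  ∃I   : ∀ {Γ Δ σ φ} → (t : Tm Γ σ) → Pf T Γ Δ (φ [ t ]) → Pf T Γ Δ (∃' σ φ)
  ∃E   : ∀ {Γ Δ σ φ χ} → Pf T Γ Δ (∃' σ φ)
         → Pf T (σ ∷ Γ) (φ ∷ map wkF Δ) (wkF χ) → Pf T Γ Δ χ

Inconsistent : Theory → Set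
Inconsistent T = Pf T [] [] ⊥'

data EHAω : Theory where
  eqRefl  : ∀ {Γ} (t : Tm Γ ι) → EHAω Γ (t ≐ t)
  eqSubst : ∀ {Γ} (φ : Fm (ι ∷ Γ)) → Internal φ → (s t : Tm Γ ι)
            → EHAω Γ ((s ≐ t) ⇒' (φ [ s ] ⇒' φ [ t ]))
  sucNZ   : ∀ {Γ} (t : Tm Γ ι) → EHAω Γ ((succ · t ≐ zero) ⇒' ⊥')
  sucInj  : ∀ {Γ} (s t : Tm Γ ι) → EHAω Γ ((succ · s ≐ succ · t) ⇒' (s ≐ t))
  Kax     : ∀ {Γ} ρ σ (x : Tm Γ ρ) (y : Tm Γ σ) → EHAω Γ (eqT ρ (K ρ σ · x · y) x)
  Sax     : ∀ {Γ} ρ σ τ (x : Tm Γ (ρ ⇒ σ ⇒ τ)) (y : Tm Γ (ρ ⇒ σ)) (z : Tm Γ ρ)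
            → EHAω Γ (eqT τ (S ρ σ τ · x · y · z) (x · z · (y · z)))
  R0      : ∀ {Γ} ρ (x : Tm Γ ρ) (y : Tm Γ (ρ ⇒ ι ⇒ ρ))
            → EHAω Γ (eqT ρ (R ρ · x · y · zero) x)
  RS      : ∀ {Γ} ρ (x : Tm Γ ρ) (y : Tm Γ (ρ ⇒ ι ⇒ ρ)) (n : Tm Γ ι)
            → EHAω Γ (eqT ρ (R ρ · x · y · (succ · n)) (y · (R ρ · x · y · n) · n))
  ind     : ∀ {Γ} (φ : Fm (ι ∷ Γ)) → Internal φ
            → EHAω Γ (φ [ zero ] ⇒' (∀' ι (φ ⇒' φ [suc]) ⇒' ∀' ι φ))
  ext     : ∀ {Γ} ρ τ (f : Tm Γ (ρ ⇒ τ)) (x y : Tm Γ ρ)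
            → EHAω Γ (eqT ρ x y ⇒' eqT τ (f · x) (f · y))

data DG : Theory where
  base   : ∀ {Γ φ} → EHAω Γ φ → DG Γ φ
  stEq   : ∀ {Γ} σ (x y : Tm Γ σ) → DG Γ (eqT σ x y ⇒' (st σ x ⇒' st σ y))
  stMaj  : ∀ {Γ} σ (x y : Tm Γ σ) → DG Γ (st σ y ⇒' (maj σ x y ⇒' st σ x))
  stCl   : ∀ {Γ} σ (t : Tm [] σ) → DG Γ (st σ (closed t))
  stApp  : ∀ {Γ} ρ τ (z : Tm Γ (ρ ⇒ τ)) (x : Tm Γ ρ)
           → DG Γ (st (ρ ⇒ τ) z ⇒' (st ρ x ⇒' st τ (z · x)))
  extInd : ∀ {Γ} (Φ : Fm (ι ∷ Γ))
           → DG Γ ((Φ [ zero ] ∧' ∀st ι (Φ ⇒' Φ [suc])) ⇒' ∀st ι Φ)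
  -- mAC^ω   (Φ(x,y) with y the topmost variable)
  mAC    : ∀ {Γ} σ τ (Φ : Fm (τ ∷ σ ∷ Γ))
           → DG Γ (∀~st σ (∃~st τ Φ)
                   ⇒' ∃~st (σ ⇒ τ) (∀~st σ (∃≤ τ (v1 · v0) (wk₂ Φ))))
  Rω     : ∀ {Γ} σ τ (Φ : Fm (τ ∷ σ ∷ Γ))
           → DG Γ (∀' σ (∃st τ Φ) ⇒' ∃~st τ (∀' σ (∃≤ τ v1 (wk₂ Φ))))
  Iω     : ∀ {Γ} σ τ (φ : Fm (τ ∷ σ ∷ Γ)) → Internal φ
           → DG Γ (∀~st τ (∃' σ (∀≤ τ v1 (wk₂ φ))) ⇒' ∃' σ (∀st τ φ))
  IP     : ∀ {Γ} σ τ (φ : Fm (σ ∷ Γ)) → Internal φ → (Ψ : Fm (τ ∷ Γ))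
           → DG Γ ((∀~st σ φ ⇒' ∃~st τ Ψ)
                   ⇒' ∃~st τ (∀~st σ (wk₁ φ) ⇒' ∃~≤ τ v0 (wk₁ Ψ)))
  Mω     : ∀ {Γ} σ (φ : Fm (σ ∷ Γ)) → Internal φ → (ψ : Fm Γ) → Internal ψ
           → DG Γ ((∀~st σ φ ⇒' ψ) ⇒' ∃~st σ (∀≤ σ v0 (wk₁ φ) ⇒' wkF ψ))
  MAJ    : ∀ {Γ} σ → DG Γ (∀st σ (∃st σ (maj σ v1 v0)))

data Π⁰₁-TRANS : Theory where
  trans : ∀ {Γ} → Π⁰₁-TRANS Γ
    (∀st (ι ⇒ ι) (∀st ι (v1 · v0 ≐ zero) ⇒' ∀' ι (v1 · v0 ≐ zero)))

-- For every bound z, the indicator f of (z, ∞) vanishes on [0, z], takes the value 1 and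
-- is majorized by λ_.1.  Idealization (Iω) turns this into a single f that vanishes at
-- every standard argument, still takes the value 1, and is ≤* λ_.1.  Since λ_.1 is
-- standard so is f, hence Π⁰₁-TRANS makes f vanish everywhere: 1 = 0.

module Submission where

open import Defs
open import Data.List using (List; []; _∷_; map)
open import Data.List.Relation.Unary.Any using (here; there)
open import Data.Product using (_×_; _,_)
open import Data.Sum using (inj₁; inj₂)
open import Data.Unit using (⊤; tt)
open import Relation.Binary.PropositionalEquality
  using (_≡_; refl; cong; cong₂; subst; subst₂) renaming (trans to ≡-trans)

private variable
  Γ Θ : Ctx
  ρ σ τ : Ty

subT-single-wkT : (u : Tm Γ τ) (s : Tm Γ σ) → subT (single u) (wkT s) ≡ s
subT-single-wkT u (var x)   = refl
subT-single-wkT u zero      = refl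
subT-single-wkT u succ      = refl
subT-single-wkT u (K _ _)   = refl
subT-single-wkT u (S _ _ _) = refl
subT-single-wkT u (R _)     = refl
subT-single-wkT u (s · t)   = cong₂ _·_ (subT-single-wkT u s) (subT-single-wkT u t)

subT-liftS-wkT : (sb : Sub Γ Θ) (a : Tm Γ σ) →
                 subT (liftS {τ = τ} sb) (wkT a) ≡ wkT (subT sb a)
subT-liftS-wkT sb (var x)   = refl
subT-liftS-wkT sb zero      = refl
subT-liftS-wkT sb succ      = refl
subT-liftS-wkT sb (K _ _)   = refl
subT-liftS-wkT sb (S _ _ _) = refl
subT-liftS-wkT sb (R _)     = refl
subT-liftS-wkT sb (s · t)   = cong₂ _·_ (subT-liftS-wkT sb s) (subT-liftS-wkT sb t)

subF-eqT : ∀ τ (sb : Sub Γ Θ) (a b : Tm Γ τ) →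
           subF sb (eqT τ a b) ≡ eqT τ (subT sb a) (subT sb b)
subF-eqT ι       sb a b = refl
subF-eqT (ρ ⇒ τ) sb a b = cong (∀' ρ) (≡-trans
  (subF-eqT τ (liftS sb) (wkT a · v0) (wkT b · v0))
  (cong₂ (λ a′ b′ → eqT τ (a′ · v0) (b′ · v0)) (subT-liftS-wkT sb a) (subT-liftS-wkT sb b)))

eqT-instantiate : ∀ τ (f g : Tm Γ (ρ ⇒ τ)) (t : Tm Γ ρ) →
                  eqT τ (wkT f · v0) (wkT g · v0) [ t ] ≡ eqT τ (f · t) (g · t)
eqT-instantiate τ f g t = ≡-trans (subF-eqT τ (single t) (wkT f · v0) (wkT g · v0))
  (cong₂ (λ f′ g′ → eqT τ (f′ · t) (g′ · t)) (subT-single-wkT t f) (subT-single-wkT t g))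

maj-internal : ∀ σ (x y : Tm Γ σ) → Internal (maj σ x y)
maj-internal ι       x y = i∃ i≐
maj-internal (ρ ⇒ τ) x y =
  i∀ (i∀ (i⇒ (maj-internal ρ _ _) (i∧ (maj-internal τ _ _) (maj-internal τ _ _))))

Spine : Ctx → Ty → Set
Spine Γ ι       = ⊤
Spine Γ (σ ⇒ τ) = Tm Γ σ × Spine Γ τ

infixl 8 _·*_
_·*_ : Tm Γ ρ → Spine Γ ρ → Tm Γ ι
_·*_ {ρ = ι}     t tt       = t
_·*_ {ρ = σ ⇒ τ} t (u , us) = t · u ·* us

T1 : Ty
T1 = ι ⇒ ι

v2 : Tm (ρ ∷ τ ∷ σ ∷ Γ) σ
v2 = var (there (there here))

one : Tm Γ ι
one = succ · zero

I : ∀ ρ → Tm Γ (ρ ⇒ ρ)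
I ρ = S ρ (ρ ⇒ ρ) ρ · K ρ (ρ ⇒ ρ) · K ρ ρ

_∘ᵗ_ : Tm Γ (σ ⇒ τ) → Tm Γ (ρ ⇒ σ) → Tm Γ (ρ ⇒ τ)
_∘ᵗ_ {σ = σ} {τ} {ρ} f g = S ρ σ τ · (K (σ ⇒ τ) ρ · f) · g

-- λ a n. f a
ignoring : Tm Γ (ρ ⇒ ρ) → Tm Γ (ρ ⇒ ι ⇒ ρ)
ignoring {ρ = ρ} f = S ρ ρ (ι ⇒ ρ) · (K (ρ ⇒ ι ⇒ ρ) ρ · K ρ ι) · f

iterator : ∀ ρ → Tm Γ ρ → Tm Γ (ρ ⇒ ρ) → Tm Γ (ι ⇒ ρ)
iterator ρ x f = R ρ · x · ignoring f

cases : ∀ ρ → Tm Γ ρ → Tm Γ (ι ⇒ ρ) → Tm Γ (ι ⇒ ρ)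
cases ρ x g = R ρ · x · (K (ι ⇒ ρ) ρ · g)

pred : Tm Γ T1
pred = cases ι zero (I ι)

sg : Tm Γ T1
sg = cases ι zero (K ι ι · one)

-- λ e y. e (pred y), written as S (S ∘ K) (K pred).
precomposePred : Tm Γ (T1 ⇒ T1)
precomposePred = S T1 T1 T1 · (S ι ι ι ∘ᵗ K T1 ι) · (K T1 T1 · pred)

-- exceeds · w · y = sg (y ∸ w): the indicator of y > w.
exceeds : Tm Γ (ι ⇒ T1)
exceeds = iterator T1 sg precomposePred

-- spike(f, n), with n the topmost variable; the last conjunct makes f standard by axiom (b).
spike : Fm (ι ∷ T1 ∷ [])
spike = (v1 · v0 ≐ zero) ∧' (∃' ι (v2 · v0 ≐ one) ∧' maj T1 v1 (K ι ι · one))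

spike-internal : Internal spike
spike-internal = i∧ i≐ (i∧ (i∃ i≐) (maj-internal T1 _ _))

module Derivations {T : Theory} (eha : ∀ {Γ φ} → EHAω Γ φ → T Γ φ) where

  private variable
    Δ : List (Fm Γ)
    φ : Fm Γ
    a b s t u : Tm Γ ι

  axiom : EHAω Γ φ → Pf T Γ Δ φ
  axiom e = ax (eha e)

  hyp₀ : Pf T Γ (φ ∷ Δ) φ
  hyp₀ = hyp (here refl)

  hyp₁ : ∀ {ψ} → Pf T Γ (ψ ∷ φ ∷ Δ) φ
  hyp₁ = hyp (there (here refl))

  ≐-refl : Pf T Γ Δ (t ≐ t)
  ≐-refl = axiom (eqRefl _)

  ≐-trans : Pf T Γ Δ (s ≐ t) → Pf T Γ Δ (t ≐ u) → Pf T Γ Δ (s ≐ u)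
  ≐-trans {Γ} {Δ} {s} {t} {u} p q = ⇒E (⇒E leibniz q) p
    where
    leibniz : Pf T Γ Δ ((t ≐ u) ⇒' ((s ≐ t) ⇒' (s ≐ u)))
    leibniz = subst₂ (λ s₁ s₂ → Pf T Γ Δ ((t ≐ u) ⇒' ((s₁ ≐ t) ⇒' (s₂ ≐ u))))
      (subT-single-wkT t s) (subT-single-wkT u s) (axiom (eqSubst (wkT s ≐ v0) i≐ t u))

  ≐-sym : Pf T Γ Δ (s ≐ t) → Pf T Γ Δ (t ≐ s)
  ≐-sym {Γ} {Δ} {s} {t} p = ⇒E (⇒E leibniz p) ≐-refl
    where
    leibniz : Pf T Γ Δ ((s ≐ t) ⇒' ((s ≐ s) ⇒' (t ≐ s)))
    leibniz = subst₂ (λ s₁ s₂ → Pf T Γ Δ ((s ≐ t) ⇒' ((s ≐ s₁) ⇒' (t ≐ s₂))))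
      (subT-single-wkT s s) (subT-single-wkT t s) (axiom (eqSubst (v0 ≐ wkT s) i≐ s t))

  infixr 2 _≐⟨_⟩_
  infix  3 _∎

  _≐⟨_⟩_ : ∀ s → Pf T Γ Δ (s ≐ t) → Pf T Γ Δ (t ≐ u) → Pf T Γ Δ (s ≐ u)
  s ≐⟨ p ⟩ q = ≐-trans p q

  _∎ : ∀ t → Pf T Γ Δ (t ≐ t)
  t ∎ = ≐-refl

  eqT-app : {f g : Tm Γ (ρ ⇒ τ)} → Pf T Γ Δ (eqT (ρ ⇒ τ) f g) →
            (t : Tm Γ ρ) → Pf T Γ Δ (eqT τ (f · t) (g · t))
  eqT-app {τ = τ} {Δ = Δ} {f} {g} p t = subst (Pf T _ Δ) (eqT-instantiate τ f g t) (∀E p t)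

  eqT-apply : {f g : Tm Γ ρ} → Pf T Γ Δ (eqT ρ f g) →
              (us : Spine Γ ρ) → Pf T Γ Δ (f ·* us ≐ g ·* us)
  eqT-apply {ρ = ι}     p tt       = p
  eqT-apply {ρ = σ ⇒ τ} p (u , us) = eqT-apply (eqT-app p u) us

  cong-eqT : (f : Tm Γ (ρ ⇒ τ)) {x y : Tm Γ ρ} → Pf T Γ Δ (eqT ρ x y) →
             (us : Spine Γ τ) → Pf T Γ Δ (f · x ·* us ≐ f · y ·* us)
  cong-eqT f {x} {y} p = eqT-apply (⇒E (axiom (ext _ _ f x y)) p)

  ≐-cong : (f : Tm Γ T1) → Pf T Γ Δ (s ≐ t) → Pf T Γ Δ (f · s ≐ f · t)
  ≐-cong f p = cong-eqT f p tt

  induction : (φ : Fm (ι ∷ Γ)) → Internal φ → Pf T Γ Δ (φ [ zero ]) →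
              Pf T (ι ∷ Γ) (φ ∷ map wkF Δ) (φ [suc]) → Pf T Γ Δ (∀' ι φ)
  induction φ i p₀ p₊ = ⇒E (⇒E (axiom (ind φ i)) p₀) (∀I (⇒I p₊))

  K-red : (x : Tm Γ ρ) (y : Tm Γ σ) (us : Spine Γ ρ) →
          Pf T Γ Δ (K ρ σ · x · y ·* us ≐ x ·* us)
  K-red x y = eqT-apply (axiom (Kax _ _ x y))

  S-red : (x : Tm Γ (ρ ⇒ σ ⇒ τ)) (y : Tm Γ (ρ ⇒ σ)) (z : Tm Γ ρ) (us : Spine Γ τ) →
          Pf T Γ Δ (S ρ σ τ · x · y · z ·* us ≐ x · z · (y · z) ·* us)
  S-red x y z = eqT-apply (axiom (Sax _ _ _ x y z))

  R-zero : (x : Tm Γ ρ) (y : Tm Γ (ρ ⇒ ι ⇒ ρ)) (us : Spine Γ ρ) →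
           Pf T Γ Δ (R ρ · x · y · zero ·* us ≐ x ·* us)
  R-zero x y = eqT-apply (axiom (R0 _ x y))

  R-suc : (x : Tm Γ ρ) (y : Tm Γ (ρ ⇒ ι ⇒ ρ)) (n : Tm Γ ι) (us : Spine Γ ρ) →
          Pf T Γ Δ (R ρ · x · y · (succ · n) ·* us ≐ y · (R ρ · x · y · n) · n ·* us)
  R-suc x y n = eqT-apply (axiom (RS _ x y n))

  I-red : (x : Tm Γ ρ) (us : Spine Γ ρ) → Pf T Γ Δ (I ρ · x ·* us ≐ x ·* us)
  I-red x us = ≐-trans (S-red _ _ x us) (K-red x _ us)

  ∘ᵗ-red : (f : Tm Γ (σ ⇒ τ)) (g : Tm Γ (ρ ⇒ σ)) (x : Tm Γ ρ) (us : Spine Γ τ) →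
           Pf T Γ Δ ((f ∘ᵗ g) · x ·* us ≐ f · (g · x) ·* us)
  ∘ᵗ-red f g x us = ≐-trans (S-red _ g x us) (K-red f x (g · x , us))

  ignoring-red : (f : Tm Γ (ρ ⇒ ρ)) (x : Tm Γ ρ) (n : Tm Γ ι) (us : Spine Γ ρ) →
                 Pf T Γ Δ (ignoring f · x · n ·* us ≐ f · x ·* us)
  ignoring-red f x n us = ≐-trans (S-red _ f x (n , us))
                         (≐-trans (K-red _ x (f · x , n , us)) (K-red (f · x) n us))

  iterator-zero : (x : Tm Γ ρ) (f : Tm Γ (ρ ⇒ ρ)) (us : Spine Γ ρ) →
                  Pf T Γ Δ (iterator ρ x f · zero ·* us ≐ x ·* us)
  iterator-zero x f = R-zero x (ignoring f)

  iterator-suc : (x : Tm Γ ρ) (f : Tm Γ (ρ ⇒ ρ)) (n : Tm Γ ι) (us : Spine Γ ρ) →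
                 Pf T Γ Δ (iterator ρ x f · (succ · n) ·* us ≐ f · (iterator ρ x f · n) ·* us)
  iterator-suc x f n us = ≐-trans (R-suc x _ n us) (ignoring-red f _ n us)

  cases-zero : (x : Tm Γ ρ) (g : Tm Γ (ι ⇒ ρ)) (us : Spine Γ ρ) →
               Pf T Γ Δ (cases ρ x g · zero ·* us ≐ x ·* us)
  cases-zero x g = R-zero x _

  cases-suc : (x : Tm Γ ρ) (g : Tm Γ (ι ⇒ ρ)) (n : Tm Γ ι) (us : Spine Γ ρ) →
              Pf T Γ Δ (cases ρ x g · (succ · n) ·* us ≐ g · n ·* us)
  cases-suc x g n us = ≐-trans (R-suc x _ n us) (K-red g _ (n , us))

  pred-zero : Pf T Γ Δ (pred · zero ≐ zero)
  pred-zero = cases-zero zero (I ι) tt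

  pred-suc : (n : Tm Γ ι) → Pf T Γ Δ (pred · (succ · n) ≐ n)
  pred-suc n = ≐-trans (cases-suc zero (I ι) n tt) (I-red n tt)

  sg-zero : Pf T Γ Δ (sg · zero ≐ zero)
  sg-zero = cases-zero zero (K ι ι · one) tt

  sg-suc : (n : Tm Γ ι) → Pf T Γ Δ (sg · (succ · n) ≐ one)
  sg-suc n = ≐-trans (cases-suc zero (K ι ι · one) n tt) (K-red one n tt)

  add-zero : (a : Tm Γ ι) → Pf T Γ Δ (add a zero ≐ a)
  add-zero a = iterator-zero a succ tt

  add-suc : (a n : Tm Γ ι) → Pf T Γ Δ (add a (succ · n) ≐ succ · add a n)
  add-suc a n = iterator-suc a succ n tt

  precomposePred-red : (e : Tm Γ T1) (y : Tm Γ ι) →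
                       Pf T Γ Δ (precomposePred · e · y ≐ e · (pred · y))
  precomposePred-red e y =
    precomposePred · e · y                                    ≐⟨ S-red _ _ e (y , tt) ⟩
    (S ι ι ι ∘ᵗ K T1 ι) · e · (K T1 T1 · pred · e) · y          ≐⟨ ∘ᵗ-red _ _ e (K T1 T1 · pred · e , y , tt) ⟩
    S ι ι ι · (K T1 ι · e) · (K T1 T1 · pred · e) · y           ≐⟨ S-red _ _ y tt ⟩
    K T1 ι · e · y · (K T1 T1 · pred · e · y)                   ≐⟨ K-red e y (K T1 T1 · pred · e · y , tt) ⟩
    e · (K T1 T1 · pred · e · y)                                ≐⟨ ≐-cong e (K-red pred e (y , tt)) ⟩
    e · (pred · y)                                              ∎

  exceeds-zero : (y : Tm Γ ι) → Pf T Γ Δ (exceeds · zero · y ≐ sg · y)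
  exceeds-zero y = iterator-zero sg precomposePred (y , tt)

  exceeds-suc : (w y : Tm Γ ι) → Pf T Γ Δ (exceeds · (succ · w) · y ≐ exceeds · w · (pred · y))
  exceeds-suc w y = ≐-trans (iterator-suc sg precomposePred w (y , tt))
                            (precomposePred-red (exceeds · w) y)

  add-congˡ : (n : Tm Γ ι) → Pf T Γ Δ (a ≐ b) → Pf T Γ Δ (add a n ≐ add b n)
  add-congˡ n p = cong-eqT (R ι) p (ignoring succ , n , tt)

  add-suc-left : Pf T Γ Δ (∀' ι (∀' ι (add (succ · v1) v0 ≐ succ · add v1 v0)))
  add-suc-left = ∀I (induction (add (succ · v1) v0 ≐ succ · add v1 v0) i≐
    (≐-trans (add-zero _) (≐-sym (≐-cong succ (add-zero _))))
    (add (succ · v1) (succ · v0)  ≐⟨ add-suc _ _ ⟩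
     succ · add (succ · v1) v0    ≐⟨ ≐-cong succ hyp₀ ⟩
     succ · (succ · add v1 v0)    ≐⟨ ≐-sym (≐-cong succ (add-suc _ _)) ⟩
     succ · add v1 (succ · v0)    ∎))

  sg-≤-one : Pf T Γ Δ (∀' ι (leq0 (sg · v0) one))
  sg-≤-one = induction (leq0 (sg · v0) one) (i∃ i≐)
    (∃I one (≐-trans (add-suc _ zero) (≐-cong succ (≐-trans (add-zero _) sg-zero))))
    (∃I zero (≐-trans (add-zero _) (sg-suc v0)))

  exceeds-at-zero : Pf T Γ Δ (∀' ι (exceeds · v0 · zero ≐ zero))
  exceeds-at-zero = induction (exceeds · v0 · zero ≐ zero) i≐
    (≐-trans (exceeds-zero zero) sg-zero)
    (exceeds · (succ · v0) · zero  ≐⟨ exceeds-suc v0 zero ⟩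
     exceeds · v0 · (pred · zero)  ≐⟨ ≐-cong (exceeds · v0) pred-zero ⟩
     exceeds · v0 · zero           ≐⟨ hyp₀ ⟩
     zero                          ∎)

  exceeds-suc-self : Pf T Γ Δ (∀' ι (exceeds · v0 · (succ · v0) ≐ one))
  exceeds-suc-self = induction (exceeds · v0 · (succ · v0) ≐ one) i≐
    (≐-trans (exceeds-zero one) (sg-suc zero))
    (exceeds · (succ · v0) · (succ · (succ · v0))  ≐⟨ exceeds-suc v0 _ ⟩
     exceeds · v0 · (pred · (succ · (succ · v0)))  ≐⟨ ≐-cong (exceeds · v0) (pred-suc _) ⟩
     exceeds · v0 · (succ · v0)                    ≐⟨ hyp₀ ⟩
     one                                           ∎)

  exceeds-vanishes-below : Pf T Γ Δ (∀' ι (∀' ι (exceeds · add v1 v0 · v1 ≐ zero)))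
  exceeds-vanishes-below = induction (∀' ι (exceeds · add v1 v0 · v1 ≐ zero)) (i∀ i≐)
    (∀I (∀E exceeds-at-zero (add zero v0)))
    (∀I (exceeds · add (succ · v1) v0 · (succ · v1)
           ≐⟨ cong-eqT exceeds (∀E (∀E add-suc-left v1) v0) (succ · v1 , tt) ⟩
         exceeds · (succ · add v1 v0) · (succ · v1)  ≐⟨ exceeds-suc _ _ ⟩
         exceeds · add v1 v0 · (pred · (succ · v1))  ≐⟨ ≐-cong (exceeds · add v1 v0) (pred-suc v1) ⟩
         exceeds · add v1 v0 · v1                    ≐⟨ ∀E hyp₀ v0 ⟩
         zero                                        ∎))

  exceeds-≤-one : Pf T Γ Δ (∀' ι (∀' ι (leq0 (exceeds · v1 · v0) one)))
  exceeds-≤-one = induction (∀' ι (leq0 (exceeds · v1 · v0) one)) (i∀ (i∃ i≐))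
    (∀I (∃E (∀E sg-≤-one v0) (∃I v0 (≐-trans (add-congˡ v0 (exceeds-zero v1)) hyp₀))))
    (∀I (∃E (∀E hyp₀ (pred · v0)) (∃I v0 (≐-trans (add-congˡ v0 (exceeds-suc v2 v1)) hyp₀))))

  exceeds-≤*-one : Pf T Γ Δ (∀' ι (maj T1 (exceeds · v0) (K ι ι · one)))
  exceeds-≤*-one = ∀I (∀I (∀I (⇒I (∧I bounded constant))))
    where
    bounded : Pf T (ι ∷ ι ∷ ι ∷ Γ) Δ (leq0 (exceeds · v2 · v1) (K ι ι · one · v0))
    bounded = ∃E (∀E (∀E exceeds-≤-one v2) v1) (∃I v0 (≐-trans hyp₀ (≐-sym (K-red one v1 tt))))
    constant : Pf T (ι ∷ ι ∷ ι ∷ Γ) Δ (leq0 (K ι ι · one · v1) (K ι ι · one · v0))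
    constant = ∃I zero (≐-trans (add-zero _) (≐-trans (K-red one v1 tt) (≐-sym (K-red one v0 tt))))

  exceeds-spikes : Pf T (ι ∷ []) Δ (∃' T1 (∀≤ ι v1 (wk₂ spike)))
  exceeds-spikes = ∃I (exceeds · v0) (∀I (⇒I (∧I vanishes (∧I hits-one (∀E exceeds-≤*-one v1)))))
    where
    vanishes : Pf T (ι ∷ ι ∷ []) (leq0 v0 v1 ∷ map wkF Δ) (exceeds · v1 · v0 ≐ zero)
    vanishes = ∃E hyp₀ (≐-trans (≐-sym (cong-eqT exceeds hyp₀ (v1 , tt)))
                                (∀E (∀E exceeds-vanishes-below v1) v0))
    hits-one : Pf T (ι ∷ ι ∷ []) (leq0 v0 v1 ∷ map wkF Δ) (∃' ι (exceeds · v2 · v0 ≐ one))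
    hits-one = ∃I (succ · v1) (∀E exceeds-suc-self v1)

open Derivations {DG ⊕ Π⁰₁-TRANS} (λ e → inj₁ (base e))

dg : ∀ {Δ φ} → DG Γ φ → Pf (DG ⊕ Π⁰₁-TRANS) Γ Δ φ
dg a = ax (inj₁ a)

Π⁰₁-transfer : ∀ {Δ} → Pf (DG ⊕ Π⁰₁-TRANS) Γ Δ
  (∀st T1 (∀st ι (v1 · v0 ≐ zero) ⇒' ∀' ι (v1 · v0 ≐ zero)))
Π⁰₁-transfer = ax (inj₂ trans)

standard-spike-absurd : Pf (DG ⊕ Π⁰₁-TRANS) (T1 ∷ []) (∀st ι spike ∷ []) ⊥'
standard-spike-absurd =
  ⇒E (∃E hits-one refute) (⇒E (⇒E (∀E Π⁰₁-transfer v0) standard) vanishes-at-standard)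
  where
  Hyp : List (Fm (T1 ∷ []))
  Hyp = ∀st ι spike ∷ []

  at-zero : Pf (DG ⊕ Π⁰₁-TRANS) (T1 ∷ []) Hyp (spike [ zero ])
  at-zero = ⇒E (∀E hyp₀ zero) (dg (stCl ι zero))

  hits-one : Pf (DG ⊕ Π⁰₁-TRANS) (T1 ∷ []) Hyp (∃' ι (v1 · v0 ≐ one))
  hits-one = ∧E₁ (∧E₂ at-zero)

  standard : Pf (DG ⊕ Π⁰₁-TRANS) (T1 ∷ []) Hyp (st T1 v0)
  standard = ⇒E (⇒E (dg (stMaj T1 v0 (K ι ι · one))) (dg (stCl T1 (K ι ι · one))))
                (∧E₂ (∧E₂ at-zero))

  vanishes-at-standard : Pf (DG ⊕ Π⁰₁-TRANS) (T1 ∷ []) Hyp (∀st ι (v1 · v0 ≐ zero))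
  vanishes-at-standard = ∀I (⇒I (∧E₁ (⇒E (∀E hyp₁ v0) hyp₀)))

  refute : Pf (DG ⊕ Π⁰₁-TRANS) (ι ∷ T1 ∷ []) ((v1 · v0 ≐ one) ∷ map wkF Hyp)
             (∀' ι (v2 · v0 ≐ zero) ⇒' ⊥')
  refute = ⇒I (⇒E (axiom (sucNZ zero)) (≐-trans (≐-sym hyp₁) (∀E hyp₀ v0)))

corollary3p9 : Inconsistent (DG ⊕ Π⁰₁-TRANS)
corollary3p9 =
  ∃E (⇒E (dg (Iω T1 ι spike spike-internal)) (∀I (⇒I exceeds-spikes))) standard-spike-absurd
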